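{- Let $k \geq 2$ be an integer, let $\mathcal{S}_k$ be the set of binary $k$'th powers, and let $E_k = \gcd(2^k-1, k)$ (which equals $\gcd(\mathcal{S}_k)$). Let $F_k$ be the Frobenius number of the set $E_k^{ -1}\mathcal{S}_k = \{ s/E_k : s \in \mathcal{S}_k\}$. Then $F_k \leq 2^{k^2+k}$.
   Context: For integers $k,n \geq 1$ let $c_k(n) := \frac{2^{kn}-1}{2^n-1}$. A natural number is a binary $k$'th power if its canonical binary representation (no leading zeros) consists of $k$ consecutive identical blocks; equivalently, it is $0$ or of the form $a \cdot c_k(n)$ with $n \geq 1$ and $2^{n-1} \leq a < 2^n$. For a set $S \subseteq \mathbb{N}$ with $\gcd(S)=1$, the Frobenius number $F(S)$ is the largest integer that cannot be written as a non-negative integer linear combination of elements of $S$. -}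

module Defs where

open import Data.Nat using (ℕ; zero; suc; _+_; _*_; _∸_; _^_; _≤_; _<_)
open import Data.Nat.GCD using (gcd)
open import Data.List using (List)
open import Data.Nat.ListAction using (sum)
open import Data.Empty using (⊥)
open import Data.List.Relation.Unary.All using (All)
open import Data.Product using (Σ; ∃; _×_)
open import Data.Sum using (_⊎_)
open import Relation.Binary.PropositionalEquality using (_≡_)

-- c k n = (2^(kn) - 1)/(2^n - 1) = Σ_{i<k} 2^(n i)  (exact geometric sum)
c : ℕ → ℕ → ℕ
c zero    n = 0
c (suc k) n = 1 + 2 ^ n * c k n

BinPow : ℕ → ℕ → Set
BinPow k s = s ≡ 0 ⊎ Σ ℕ λ n → Σ ℕ λ a →
  1 ≤ n × 2 ^ (n ∸ 1) ≤ a × a < 2 ^ n × s ≡ a * c k n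

E : ℕ → ℕ
E k = gcd (2 ^ k ∸ 1) k

-- membership in E_k^{-1} S_k = { s / E_k : s ∈ S_k } (E_k ≥ 1 always divides s ∈ S_k;
-- m is in the set iff m * E_k ∈ S_k)
ScaledBinPow : ℕ → ℕ → Set
ScaledBinPow k m = BinPow k (m * E k)

Representable : (ℕ → Set) → ℕ → Set
Representable P n = Σ (List ℕ) λ xs → All P xs × sum xs ≡ n

IsFrobenius : (ℕ → Set) → ℕ → Set
IsFrobenius P F = (Representable P F → ⊥) × (∀ m → F < m → Representable P m)

{-# OPTIONS --safe #-}
-- Let p = 2^k − 1 and D = c_k(k). Both p = 1·c_k(1) and x·D for 2^(k−1) ≤ x < 2^k are binary
-- k'th powers, and every β ≥ 2^(k−1) is a sum of numbers in [2^(k−1), 2^k). Since c_k(k) ≡ k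
-- (mod p), gcd(p, D) = gcd(p, k) = E_k, so g₁ = p/E_k and g₂ = D/E_k are coprime and every
-- m ≥ g₁g₂ + 2^(k−1)g₂ is α g₁ + β g₂ with β ≥ 2^(k−1), hence representable. This threshold is
-- at most 2^k·p·D < 2^(k²+k); since 1 is not representable and representability is decidable,
-- the Frobenius number exists and lies below it.
module Submission where

open import Defs
open import Data.Nat
  using (ℕ; zero; suc; _+_; _*_; _∸_; _^_; _≤_; _<_; z≤n; s≤s; _≟_; _≤?_; _<?_;
         NonZero; ≢-nonZero; ≢-nonZero⁻¹; >-nonZero; >-nonZero⁻¹)
open import Data.Nat.Properties
open import Data.Nat.DivMod using (_/_; _%_; m≡m%n+[m/n]*n; m%n<n)
open import Data.Nat.Divisibility using (quotient; m∣n⇒n≡quotient*m; ∣⇒≤; ∣-trans; n∣m*n; ∣m+n∣m⇒∣n)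
open import Data.Nat.GCD using (gcd; gcd[m,n]∣m; gcd[m,n]∣n; gcd[m,n]≢0; gcd-GCD; module Bézout)
open import Data.Nat.Coprimality using (Coprime; Bézout-coprime; coprime-Bézout)
open import Data.Nat.Induction using (<-rec)
open import Data.Nat.ListAction using (sum)
open import Data.Nat.ListAction.Properties using (sum-++)
open import Data.Nat.Tactic.RingSolver using (solve-∀)
open import Data.List using ([]; _∷_; _++_; [_])
open import Data.List.Relation.Unary.All using (All; []; _∷_)
open import Data.List.Relation.Unary.All.Properties using (++⁺)
open import Data.Product using (Σ; _×_; _,_; proj₁; proj₂; ∃-syntax; ∃₂)
open import Data.Sum using (inj₁; inj₂; map₂)
open import Function using (_∘_)
open import Relation.Nullary using (Dec; yes; no; ¬_; contradiction)
open import Relation.Nullary.Decidable using (map′; _×-dec_; _⊎-dec_)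
open import Relation.Unary using (Decidable)
open import Relation.Binary.PropositionalEquality
  using (_≡_; refl; sym; trans; cong; cong₂; subst; subst₂; module ≡-Reasoning)

module _ {P : ℕ → Set} where

  representable-0 : Representable P 0
  representable-0 = [] , [] , refl

  representable-+ : ∀ {m n} → Representable P m → Representable P n → Representable P (m + n)
  representable-+ (xs , pxs , refl) (ys , pys , refl) = xs ++ ys , ++⁺ pxs pys , sum-++ xs ys

  representable-∈ : ∀ {x} → P x → Representable P x
  representable-∈ {x} px = [ x ] , px ∷ [] , +-identityʳ x

  representable-* : ∀ {x} q → P x → Representable P (q * x)
  representable-* zero    px = representable-0
  representable-* (suc q) px = representable-+ (representable-∈ px) (representable-* q px)

  representable-suc⁺ : ∀ {m y} → y < suc m → P (suc y) → Representable P (m ∸ y) →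
                       Representable P (suc m)
  representable-suc⁺ (s≤s y≤m) py r =
    subst (Representable P) (cong suc (m+[n∸m]≡n y≤m)) (representable-+ (representable-∈ py) r)

  representable-suc⁻ : ∀ {m} → Representable P (suc m) →
                       ∃[ y ] y < suc m × P (suc y) × Representable P (m ∸ y)
  representable-suc⁻ ([] , [] , ())
  representable-suc⁻ (zero ∷ xs , _ ∷ pxs , eq) = representable-suc⁻ (xs , pxs , eq)
  representable-suc⁻ (suc y ∷ xs , py ∷ pxs , refl) =
    y , s≤s (m≤m+n y (sum xs)) , py , xs , pxs , sym (m+n∸m≡n y (sum xs))

  representable? : Decidable P → Decidable (Representable P)
  representable? P? = <-rec (Dec ∘ Representable P) step
    where
    step : ∀ m → (∀ {n} → n < m → Dec (Representable P n)) → Dec (Representable P m)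
    step zero    _   = yes representable-0
    step (suc m) rec = map′ (λ (_ , y<1+m , py , r) → representable-suc⁺ y<1+m py r)
                            representable-suc⁻
                            (anyUpTo? (λ y → P? (suc y) ×-dec rec (s≤s (m∸n≤m m y))) (suc m))

  isFrobenius-below : Decidable (Representable P) → ∀ {n} → ¬ Representable P n →
                      ∀ N → (∀ m → N ≤ m → Representable P m) → ∃[ F ] IsFrobenius P F × F < N
  isFrobenius-below rep? {n} ¬rₙ zero    rep≥ = contradiction (rep≥ n z≤n) ¬rₙ
  isFrobenius-below rep? {n} ¬rₙ (suc N) rep> with rep? N
  ... | no ¬r = N , (¬r , rep>) , ≤-refl
  ... | yes r =
    let F , isF , F<N = isFrobenius-below rep? ¬rₙ N rep≥ in F , isF , m<n⇒m<1+n F<N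
    where
    rep≥ : ∀ m → N ≤ m → Representable P m
    rep≥ m N≤m with m≤n⇒m<n∨m≡n N≤m
    ... | inj₁ N<m  = rep> m N<m
    ... | inj₂ refl = r

  representable-≥ : ∀ L .{{_ : NonZero L}} → (∀ x → L ≤ x → x < L + L → P x) →
                    ∀ n → L ≤ n → Representable P n
  representable-≥ L P-window = <-rec _ step
    where
    step : ∀ n → (∀ {m} → m < n → L ≤ m → Representable P m) → L ≤ n → Representable P n
    step n rec L≤n with n <? L + L
    ... | yes n<2L = representable-∈ (P-window n L≤n n<2L)
    ... | no  n≮2L = subst (Representable P) (m∸n+n≡m L≤n)
      (representable-+ (rec (∸-monoʳ-< (>-nonZero⁻¹ L) L≤n) (m+n≤o⇒m≤o∸n L (≮⇒≥ n≮2L)))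
                       (representable-∈ (P-window L ≤-refl (m<m+n L (>-nonZero⁻¹ L)))))

representable-scale : ∀ {P : ℕ → Set} g {n} → Representable (λ x → P (x * g)) n →
                      Representable P (n * g)
representable-scale {P} g (xs , pxs , refl) = go xs pxs
  where
  go : ∀ xs → All (λ x → P (x * g)) xs → Representable P (sum xs * g)
  go []       []         = representable-0
  go (x ∷ xs) (px ∷ pxs) = subst (Representable P) (sym (*-distribʳ-+ g x (sum xs)))
                                 (representable-+ (representable-∈ px) (go xs pxs))

x+y*a≡n+z*a⇒n≡x+[y∸z]*a : ∀ {x} y z a {n} → x + y * a ≡ n + z * a → x ≤ n → n ≡ x + (y ∸ z) * a
x+y*a≡n+z*a⇒n≡x+[y∸z]*a {x} y z a {n} eq x≤n = begin
  n                       ≡⟨ m+[n∸m]≡n x≤n ⟨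
  x + d                   ≡⟨ cong (x +_) (m+n∸n≡m d (z * a)) ⟨
  x + (d + z * a ∸ z * a) ≡⟨ cong (λ w → x + (w ∸ z * a)) d+za≡ya ⟩
  x + (y * a ∸ z * a)     ≡⟨ cong (x +_) (*-distribʳ-∸ a y z) ⟨
  x + (y ∸ z) * a         ∎
  where
  open ≡-Reasoning
  d = n ∸ x
  d+za≡ya : d + z * a ≡ y * a
  d+za≡ya = +-cancelˡ-≡ x _ _ (begin
    x + (d + z * a) ≡⟨ +-assoc x d (z * a) ⟨
    x + d + z * a   ≡⟨ cong (_+ z * a) (m+[n∸m]≡n x≤n) ⟩
    n + z * a       ≡⟨ eq ⟨
    x + y * a       ∎)

bézout⇒combination : ∀ {a b} u v .{{_ : NonZero a}} → u * b ≡ 1 + v * a →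
                     ∀ {n} → a * b ≤ n → ∃₂ λ α β → n ≡ α * a + β * b
bézout⇒combination {a} {b} u v ub≡1+va {n} ab≤n =
  q * b ∸ n * v , t ,
  trans (x+y*a≡n+z*a⇒n≡x+[y∸z]*a (q * b) (n * v) a combination tb≤n) (+-comm (t * b) _)
  where
  open ≡-Reasoning
  -- u inverts b modulo a, so t b ≡ n (mod a); `combination` is this congruence made exact.
  t = n * u % a
  q = n * u / a
  tb≤n : t * b ≤ n
  tb≤n = ≤-trans (*-monoˡ-≤ b (<⇒≤ (m%n<n (n * u) a))) ab≤n
  combination : t * b + q * b * a ≡ n + n * v * a
  combination = begin
    t * b + q * b * a   ≡⟨ collect t q a b ⟩
    (t + q * a) * b     ≡⟨ cong (_* b) (m≡m%n+[m/n]*n (n * u) a) ⟨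
    n * u * b           ≡⟨ *-assoc n u b ⟩
    n * (u * b)         ≡⟨ cong (n *_) ub≡1+va ⟩
    n * (1 + v * a)     ≡⟨ expand n v a ⟩
    n + n * v * a       ∎
    where
    collect : ∀ t q a b → t * b + q * b * a ≡ (t + q * a) * b
    collect = solve-∀
    expand : ∀ n v a → n * (1 + v * a) ≡ n + n * v * a
    expand = solve-∀

coprime⇒combination : ∀ {a b} .{{_ : NonZero a}} .{{_ : NonZero b}} → Coprime a b →
                      ∀ {n} → a * b ≤ n → ∃₂ λ α β → n ≡ α * a + β * b
coprime⇒combination {a} {b} coprime {n} ab≤n with coprime-Bézout coprime
... | Bézout.-+ x y 1+xa≡yb = bézout⇒combination y x (sym 1+xa≡yb) ab≤n
... | Bézout.+- x y 1+yb≡xa =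
  let α , β , n≡αb+βa = bézout⇒combination x y (sym 1+yb≡xa) (subst (_≤ n) (*-comm a b) ab≤n)
  in β , α , trans n≡αb+βa (+-comm (α * b) (β * a))

coprime-*+ : ∀ {m n} q → Coprime m n → Coprime m (q * m + n)
coprime-*+ q coprime (d∣m , d∣qm+n) = coprime (d∣m , ∣m+n∣m⇒∣n d∣qm+n (∣-trans d∣m (n∣m*n q)))

1+[2^n∸1]≡2^n : ∀ n → suc (2 ^ n ∸ 1) ≡ 2 ^ n
1+[2^n∸1]≡2^n n = m+[n∸m]≡n (m^n>0 2 n)

c-geometric : ∀ n k → (2 ^ n ∸ 1) * c k n + 1 ≡ 2 ^ (n * k)
c-geometric n zero    = cong₂ _+_ (*-zeroʳ (2 ^ n ∸ 1)) (sym (cong (2 ^_) (*-zeroʳ n)))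
c-geometric n (suc k) = begin
  p * (1 + 2 ^ n * c k n) + 1 ≡⟨ cong (λ x → p * (1 + x * c k n) + 1) (1+[2^n∸1]≡2^n n) ⟨
  p * (1 + suc p * c k n) + 1 ≡⟨ telescope p (c k n) ⟩
  suc p * (p * c k n + 1)     ≡⟨ cong₂ _*_ (1+[2^n∸1]≡2^n n) (c-geometric n k) ⟩
  2 ^ n * 2 ^ (n * k)         ≡⟨ ^-distribˡ-+-* 2 n (n * k) ⟨
  2 ^ (n + n * k)             ≡⟨ cong (2 ^_) (*-suc n k) ⟨
  2 ^ (n * suc k)             ∎
  where
  open ≡-Reasoning
  p = 2 ^ n ∸ 1
  telescope : ∀ p C → p * (1 + suc p * C) + 1 ≡ suc p * (p * C + 1)
  telescope = solve-∀

c≡k-mod-[2^n∸1] : ∀ n k → ∃[ q ] c k n ≡ q * (2 ^ n ∸ 1) + k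
c≡k-mod-[2^n∸1] n zero    = 0 , refl
c≡k-mod-[2^n∸1] n (suc k) =
  let q , c≡qp+k = c≡k-mod-[2^n∸1] n k in
  q * 2 ^ n + k , (begin
    1 + 2 ^ n * c k n               ≡⟨ cong₂ (λ x y → 1 + x * y) (1+[2^n∸1]≡2^n n) (sym c≡qp+k) ⟨
    1 + suc p * (q * p + k)         ≡⟨ regroup p q k ⟩
    (q * suc p + k) * p + suc k     ≡⟨ cong (λ x → (q * x + k) * p + suc k) (1+[2^n∸1]≡2^n n) ⟩
    (q * 2 ^ n + k) * p + suc k     ∎)
  where
  open ≡-Reasoning
  p = 2 ^ n ∸ 1
  regroup : ∀ p q k → 1 + suc p * (q * p + k) ≡ (q * suc p + k) * p + suc k
  regroup = solve-∀

k≤c : ∀ k n → k ≤ c k n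
k≤c zero    n = z≤n
k≤c (suc k) n = s≤s (≤-trans (k≤c k n) (m≤n*m (c k n) (2 ^ n) {{m^n≢0 2 n}}))

k<c : ∀ k n → 2 ≤ k → 1 ≤ n → k < c k n
k<c (suc zero)    _       (s≤s ()) _
k<c (suc (suc k)) (suc n) _ _ = s≤s (begin
  2 + k           ≤⟨ +-mono-≤ (s≤s z≤n) (≤-trans (k≤c (suc k) (suc n)) (m≤m+n C 0)) ⟩
  2 * C           ≤⟨ *-monoˡ-≤ C (*-monoʳ-≤ 2 (m^n>0 2 n)) ⟩
  2 ^ suc n * C   ∎)
  where
  open ≤-Reasoning
  C = c (suc k) (suc n)

n≤2^[n∸1] : ∀ n → n ≤ 2 ^ (n ∸ 1)
n≤2^[n∸1] zero    = z≤n
n≤2^[n∸1] (suc n) = n<2^n n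
  where
  n<2^n : ∀ n → n < 2 ^ n
  n<2^n zero    = s≤s z≤n
  n<2^n (suc n) = +-mono-≤ (m^n>0 2 n) (≤-trans (n<2^n n) (m≤m+n (2 ^ n) 0))

binPow? : ∀ k → Decidable (BinPow (suc k))
binPow? k s = map′ (map₂ forget) (map₂ bound)
  (s ≟ 0 ⊎-dec anyUpTo? (λ n → anyUpTo? (λ a → block? n a) (suc s)) (suc s))
  where
  Block : ℕ → ℕ → Set
  Block n a = 1 ≤ n × 2 ^ (n ∸ 1) ≤ a × a < 2 ^ n × s ≡ a * c (suc k) n
  block? : ∀ n a → Dec (Block n a)
  block? n a = (1 ≤? n) ×-dec (2 ^ (n ∸ 1) ≤? a) ×-dec (a <? 2 ^ n) ×-dec (s ≟ a * c (suc k) n)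
  forget : ∃[ n ] n < suc s × ∃[ a ] a < suc s × Block n a → ∃₂ Block
  forget (n , _ , a , _ , b) = n , a , b
  bound : ∃₂ Block → ∃[ n ] n < suc s × ∃[ a ] a < suc s × Block n a
  bound (n , a , b@(_ , 2^[n∸1]≤a , _ , s≡a*c)) =
    n , s≤s (≤-trans (≤-trans (n≤2^[n∸1] n) 2^[n∸1]≤a) a≤s) , a , s≤s a≤s , b
    where
    a≤s : a ≤ s
    a≤s = subst (a ≤_) (sym s≡a*c) (m≤m*n a (c (suc k) n))

module ScaledBinaryPowers (k₁ : ℕ) (1≤k₁ : 1 ≤ k₁) where

  k = suc k₁
  S = ScaledBinPow k
  L = 2 ^ k₁
  p = 2 ^ k ∸ 1
  E∣p = gcd[m,n]∣m p k
  E∣k = gcd[m,n]∣n p k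
  g₁ = quotient E∣p
  h  = quotient E∣k
  q  = proj₁ (c≡k-mod-[2^n∸1] k k)
  g₂ = q * g₁ + h

  instance
    E≢0 : NonZero (E k)
    E≢0 = ≢-nonZero (gcd[m,n]≢0 p k (inj₂ λ ()))

    L≢0 : NonZero L
    L≢0 = m^n≢0 2 k₁

  p≡g₁*E : p ≡ g₁ * E k
  p≡g₁*E = m∣n⇒n≡quotient*m E∣p

  k≡h*E : k ≡ h * E k
  k≡h*E = m∣n⇒n≡quotient*m E∣k

  c[k,k]≡g₂*E : c k k ≡ g₂ * E k
  c[k,k]≡g₂*E = begin
    c k k                    ≡⟨ proj₂ (c≡k-mod-[2^n∸1] k k) ⟩
    q * p + k                ≡⟨ cong₂ (λ x y → q * x + y) p≡g₁*E k≡h*E ⟩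
    q * (g₁ * E k) + h * E k ≡⟨ factor q g₁ h (E k) ⟩
    g₂ * E k                 ∎
    where
    open ≡-Reasoning
    factor : ∀ q g h e → q * (g * e) + h * e ≡ (q * g + h) * e
    factor = solve-∀

  c[k,1]≡p : c k 1 ≡ p
  c[k,1]≡p = begin
    c k 1               ≡⟨ m+n∸n≡m (c k 1) 1 ⟨
    c k 1 + 1 ∸ 1       ≡⟨ cong (λ x → x + 1 ∸ 1) (*-identityˡ (c k 1)) ⟨
    1 * c k 1 + 1 ∸ 1   ≡⟨ cong (_∸ 1) (c-geometric 1 k) ⟩
    2 ^ (1 * k) ∸ 1     ≡⟨ cong (λ x → 2 ^ x ∸ 1) (*-identityˡ k) ⟩
    p                   ∎
    where open ≡-Reasoning

  instance
    g₁≢0 : NonZero g₁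
    g₁≢0 = m*n≢0⇒m≢0 g₁ {{subst NonZero (trans c[k,1]≡p p≡g₁*E) _}}

    g₂≢0 : NonZero g₂
    g₂≢0 = m*n≢0⇒m≢0 g₂ {{subst NonZero c[k,k]≡g₂*E _}}

  coprime-g₁-g₂ : Coprime g₁ g₂
  coprime-g₁-g₂ = coprime-*+ q (Bézout-coprime
    (subst₂ (Bézout.Identity (E k)) p≡g₁*E k≡h*E (Bézout.identity (gcd-GCD p k))))

  scaledBinPow? : Decidable S
  scaledBinPow? m = binPow? k₁ (m * E k)

  g₁∈S : S g₁
  g₁∈S = inj₂ (1 , 1 , ≤-refl , ≤-refl , s≤s (s≤s z≤n) ,
               trans (sym p≡g₁*E) (trans (sym c[k,1]≡p) (sym (*-identityˡ (c k 1)))))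

  window*g₂⊆S : ∀ x → L ≤ x → x < L + L → S (x * g₂)
  window*g₂⊆S x L≤x x<2L = inj₂ (k , x , s≤s z≤n , L≤x ,
    subst (x <_) (cong (L +_) (sym (+-identityʳ L))) x<2L ,
    trans (*-assoc x g₂ (E k)) (cong (x *_) (sym c[k,k]≡g₂*E)))

  1∉S : ¬ S 1
  1∉S (inj₁ 1*E≡0) = ≢-nonZero⁻¹ (E k) (trans (sym (*-identityˡ (E k))) 1*E≡0)
  1∉S (inj₂ (n , a , 1≤n , 2^[n∸1]≤a , _ , 1*E≡a*c)) = <-irrefl 1*E≡a*c (begin-strict
    1 * E k   ≡⟨ *-identityˡ (E k) ⟩
    E k       ≤⟨ ∣⇒≤ E∣k ⟩
    k         <⟨ k<c k n (s≤s 1≤k₁) 1≤n ⟩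
    c k n     ≤⟨ m≤n*m (c k n) a {{>-nonZero (≤-trans (m^n>0 2 (n ∸ 1)) 2^[n∸1]≤a)}} ⟩
    a * c k n ∎)
    where open ≤-Reasoning

  ¬representable-1 : ¬ Representable S 1
  ¬representable-1 r with representable-suc⁻ r
  ... | zero  , _         , 1∈S , _ = 1∉S 1∈S
  ... | suc _ , s≤s ()    , _

  T = g₁ * g₂ + L * g₂

  representable-≥T : ∀ m → T ≤ m → Representable S m
  representable-≥T m T≤m =
    from-combination (coprime⇒combination coprime-g₁-g₂ (m+n≤o⇒m≤o∸n (g₁ * g₂) T≤m))
    where
    open ≡-Reasoning
    regroup : ∀ α g β L h → α * g + (β + L) * h ≡ α * g + β * h + L * h
    regroup = solve-∀
    from-combination : ∃₂ (λ α β → m ∸ L * g₂ ≡ α * g₁ + β * g₂) → Representable S m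
    from-combination (α , β , eq) = subst (Representable S) (begin
        α * g₁ + (β + L) * g₂         ≡⟨ regroup α g₁ β L g₂ ⟩
        α * g₁ + β * g₂ + L * g₂      ≡⟨ cong (_+ L * g₂) eq ⟨
        m ∸ L * g₂ + L * g₂           ≡⟨ m∸n+n≡m (m+n≤o⇒n≤o (g₁ * g₂) T≤m) ⟩
        m                             ∎)
      (representable-+ (representable-* α g₁∈S)
        (representable-scale g₂ (representable-≥ L window*g₂⊆S (β + L) (m≤n+m L β))))

  T≤2^[k*k+k] : T ≤ 2 ^ (k * k + k)
  T≤2^[k*k+k] = begin
    g₁ * g₂ + L * g₂        ≤⟨ +-monoʳ-≤ (g₁ * g₂) (*-monoʳ-≤ L (m≤n*m g₂ g₁)) ⟩
    suc L * (g₁ * g₂)       ≤⟨ *-mono-≤ (+-mono-≤ (m^n>0 2 k₁) (m≤m+n L 0)) (*-mono-≤ g₁≤p g₂≤c) ⟩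
    2 ^ k * (p * c k k)     ≤⟨ *-monoʳ-≤ (2 ^ k) (≤-trans (m≤m+n (p * c k k) 1) (≤-reflexive (c-geometric k k))) ⟩
    2 ^ k * 2 ^ (k * k)     ≡⟨ ^-distribˡ-+-* 2 k (k * k) ⟨
    2 ^ (k + k * k)         ≡⟨ cong (2 ^_) (+-comm k (k * k)) ⟩
    2 ^ (k * k + k)         ∎
    where
    open ≤-Reasoning
    g₁≤p : g₁ ≤ p
    g₁≤p = ≤-trans (m≤m*n g₁ (E k)) (≤-reflexive (sym p≡g₁*E))
    g₂≤c : g₂ ≤ c k k
    g₂≤c = ≤-trans (m≤m*n g₂ (E k)) (≤-reflexive (sym c[k,k]≡g₂*E))

lemma14 : (k : ℕ) → 2 ≤ k →
    Σ ℕ λ F → IsFrobenius (ScaledBinPow k) F × F ≤ 2 ^ (k * k + k)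
lemma14 (suc k₁) (s≤s 1≤k₁) =
  let F , isFrobenius , F<T =
        isFrobenius-below (representable? scaledBinPow?) ¬representable-1 T representable-≥T
  in F , isFrobenius , ≤-trans (<⇒≤ F<T) T≤2^[k*k+k]
  where open ScaledBinaryPowers k₁ 1≤k₁
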